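{- If $N,n,r,s$ are positive integers with $n\ge 3$ and $r>s$ such that $R_2(n;r,s)>N$, then $R_3(n+1;2r,s)>2^N$.
   Context: For positive integers $n,k,r,s$ with $n>k$ and $r>s$, an $(r,s)$-coloring of the complete $k$-uniform hypergraph $K_N^{(k)}$ is a map $\chi:E(K_N^{(k)})\to\binom{[r]}{s}$. A monochromatic $n$-clique is a set of $n$ vertices such that all $\binom{n}{k}$ edges within it contain a common color. $R_k(n;r,s)$ is the minimum $N$ such that every $(r,s)$-coloring of $K_N^{(k)}$ contains a monochromatic $n$-clique. -}

module Defs where

open import Data.Nat using (ℕ; _≤_)
open import Data.Fin using (Fin)
open import Data.Fin.Subset using (Subset; ∣_∣; _⊆_; _∈_)
open import Data.Product using (Σ; ∃; _×_)
open import Relation.Binary.PropositionalEquality using (_≡_)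
open import Relation.Nullary using (¬_)

-- The complete k-uniform hypergraph K_N^(k) has vertex set Fin N and edges the
-- subsets e of Fin N with ∣ e ∣ ≡ k.  An (r,s)-coloring assigns to every edge an
-- s-element subset of the colour set Fin r.  We represent it as a map on all
-- subsets of Fin N; only its values on k-element subsets matter.
IsRSColoring : (k N r s : ℕ) → (Subset N → Subset r) → Set
IsRSColoring k N r s χ = ∀ (e : Subset N) → ∣ e ∣ ≡ k → ∣ χ e ∣ ≡ s

MonoClique : (k n N r : ℕ) → (Subset N → Subset r) → Set
MonoClique k n N r χ =
  Σ (Subset N) λ S → ∣ S ∣ ≡ n × ∃ λ (c : Fin r) →
    ∀ (e : Subset N) → e ⊆ S → ∣ e ∣ ≡ k → c ∈ χ e

Arrows : (k n r s N : ℕ) → Set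
Arrows k n r s N =
  ∀ (χ : Subset N → Subset r) → IsRSColoring k N r s χ → MonoClique k n N r χ

-- R_k(n;r,s) > N : since R_k(n;r,s) is the minimum N' with Arrows k n r s N',
-- it exceeds N exactly when no N' ≤ N has the arrow property.
RamseyGt : (k n r s N : ℕ) → Set
RamseyGt k n r s N = ∀ (M : ℕ) → M ≤ N → ¬ Arrows k n r s M

-- Stepping up.  Encode the M ≤ 2^N vertices as bit strings of
-- length N in lexicographic order and let δ(x,y) be the first position where
-- x < y differ.  For x < y < z, δ(x,y) ≠ δ(y,z) and δ(x,z) is the smaller of
-- the two.  Colour the triple xyz with φ{δ(x,y),δ(y,z)}, placed in the first
-- copy of the r colours if δ(x,y) < δ(y,z) and in the second copy otherwise.
-- In a monochromatic clique a₀ < … < aₙ every triple then ascends (or every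
-- triple descends), so the gaps δᵢ = δ(aᵢ,aᵢ₊₁) are strictly monotone,
-- δ(aᵢ,aⱼ) = δᵢ (resp. δ(aᵢ,aⱼ₊₁) = δⱼ), and the triple aᵢaⱼaⱼ₊₁ (resp.
-- aᵢaᵢ₊₁aⱼ₊₁) shows that φ{δᵢ,δⱼ} contains the common colour: the n gaps form a
-- monochromatic clique of φ.

module Submission where

open import Defs
open import Data.Bool using (Bool; true; false)
import Data.Bool as Bool
open import Data.Empty using (⊥-elim)
open import Data.Fin using (Fin; zero; suc; toℕ; fromℕ<; splitAt; _↑ˡ_)
import Data.Fin as Fin
import Data.Fin.Properties as Finₚ
open import Data.Fin.Subset
  using (Subset; ∣_∣; _⊆_; _∈_; ⊥; ⁅_⁆; _∪_; inside; outside)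
open import Data.Fin.Subset.Properties
  using (∉⊥; ∣⊥∣≡0; x∈⁅x⁆; x∈⁅y⁆⇒x≡y; x∈p∪q⁺; x∈p∪q⁻; ⊆-antisym)
open import Data.List using (List; []; _∷_; length; map; foldr; applyUpTo; applyDownFrom)
open import Data.List.Properties using (length-map; length-applyUpTo; length-applyDownFrom)
open import Data.List.Membership.Propositional renaming (_∈_ to _∈ₗ_)
open import Data.List.Membership.Propositional.Properties using (∈-map⁺; ∈-map⁻)
open import Data.List.Relation.Unary.All as All using (All; []; _∷_)
import Data.List.Relation.Unary.All.Properties as Allₚ
open import Data.List.Relation.Unary.AllPairs as AllPairs using (AllPairs; []; _∷_)
open import Data.List.Relation.Unary.AllPairs.Properties using (map⁺; applyUpTo⁺₁; applyDownFrom⁺₁)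
open import Data.List.Relation.Unary.Any using (here; there)
open import Data.Nat using (ℕ; zero; suc; _≤_; _<_; _+_; _*_; _∸_; _^_; z<s; s<s; _≤?_)
open import Data.Nat.Properties
  using (≤-refl; <⇒≤; <-≤-trans; ≤-<-trans; n<1+n; m≤n⇒m<n∨m≡n; ≰⇒>;
         +-identityʳ; +-comm; m+n∸m≡n; ∸-monoˡ-<)
open import Data.Product using (Σ; ∃; ∃₂; _×_; _,_; proj₁; proj₂)
open import Data.Sum using (_⊎_; inj₁; inj₂)
open import Data.Vec using (Vec; []; _∷_; _++_; lookup; here; there)
open import Data.Vec.Properties using (lookup-++ˡ; lookup-++ʳ; []=⇒lookup; lookup⇒[]=)
open import Data.Vec.Relation.Binary.Lex.Strict using (Lex-<; base; this; next)
open import Function using (_∘_)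
open import Relation.Binary.Definitions using (Asymmetric)
open import Relation.Binary.PropositionalEquality
open import Relation.Nullary using (yes; no; ¬_)

private
  variable
    m n : ℕ

module _ {A : Set} {_≺_ : A → A → Set} (≺-asym : Asymmetric _≺_) where

  strictlySorted-unique : ∀ {xs ys} → AllPairs _≺_ xs → AllPairs _≺_ ys →
    (∀ {z} → z ∈ₗ xs → z ∈ₗ ys) → (∀ {z} → z ∈ₗ ys → z ∈ₗ xs) → xs ≡ ys
  strictlySorted-unique {[]} {[]} _ _ _ _ = refl
  strictlySorted-unique {[]} {_ ∷ _} _ _ _ ys⊆xs with () ← ys⊆xs (here refl)
  strictlySorted-unique {_ ∷ _} {[]} _ _ xs⊆ys _ with () ← xs⊆ys (here refl)
  strictlySorted-unique {x ∷ xs} {y ∷ ys} (x≺xs ∷ xs↗) (y≺ys ∷ ys↗) xs⊆ys ys⊆xs =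
    cong₂ _∷_ x≡y
      (strictlySorted-unique xs↗ ys↗ (drop-head x≺xs x≡y xs⊆ys) (drop-head y≺ys (sym x≡y) ys⊆xs))
    where
    x≡y : x ≡ y
    x≡y with xs⊆ys (here refl) | ys⊆xs (here refl)
    ... | here x≡y | _ = x≡y
    ... | there _ | here y≡x = sym y≡x
    ... | there x∈ys | there y∈xs = ⊥-elim (≺-asym (All.lookup x≺xs y∈xs) (All.lookup y≺ys x∈ys))

    drop-head : ∀ {u us v vs} → All (u ≺_) us → u ≡ v →
      (∀ {z} → z ∈ₗ u ∷ us → z ∈ₗ v ∷ vs) → ∀ {z} → z ∈ₗ us → z ∈ₗ vs
    drop-head u≺us refl ⊆ z∈us with ⊆ (there z∈us)
    ... | there z∈vs = z∈vs
    ... | here refl = ⊥-elim (≺-asym u≺u u≺u) where u≺u = All.lookup u≺us z∈us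

module _ {A : Set} {R : A → A → Set} where

  AllPairs-∈ : ∀ {xs x y} → AllPairs R xs → x ∈ₗ xs → y ∈ₗ xs → x ≢ y → R x y ⊎ R y x
  AllPairs-∈ (_ ∷ _) (here refl) (here refl) x≢y = ⊥-elim (x≢y refl)
  AllPairs-∈ (Rx ∷ _) (here refl) (there y∈xs) _ = inj₁ (All.lookup Rx y∈xs)
  AllPairs-∈ (Ry ∷ _) (there x∈xs) (here refl) _ = inj₂ (All.lookup Ry x∈xs)
  AllPairs-∈ (_ ∷ xs↗) (there x∈xs) (there y∈xs) x≢y = AllPairs-∈ xs↗ x∈xs y∈xs x≢y

module _ {A : Set} where

  nth : A → List A → ℕ → A
  nth d [] _ = d
  nth _ (x ∷ _) zero = x
  nth d (_ ∷ xs) (suc i) = nth d xs i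

  nth-∈ : ∀ d xs {i} → i < length xs → nth d xs i ∈ₗ xs
  nth-∈ d (x ∷ xs) {zero} _ = here refl
  nth-∈ d (x ∷ xs) {suc i} (s<s i<n) = there (nth-∈ d xs i<n)

  nth-AllPairs : ∀ {R : A → A → Set} d {xs i j} → AllPairs R xs → i < j → j < length xs → R (nth d xs i) (nth d xs j)
  nth-AllPairs d {x ∷ xs} {zero} {suc j} (Rx ∷ _) _ (s<s j<n) = All.lookup Rx (nth-∈ d xs j<n)
  nth-AllPairs d {x ∷ xs} {suc i} {suc j} (_ ∷ xs↗) (s<s i<j) (s<s j<n) = nth-AllPairs d xs↗ i<j j<n

-- Subsets of Fin m as strictly increasing lists

elements : Subset m → List (Fin m)
elements [] = []
elements (inside ∷ p) = zero ∷ map suc (elements p)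
elements (outside ∷ p) = map suc (elements p)

length-elements : ∀ (p : Subset m) → length (elements p) ≡ ∣ p ∣
length-elements [] = refl
length-elements (inside ∷ p) = cong suc (trans (length-map suc (elements p)) (length-elements p))
length-elements (outside ∷ p) = trans (length-map suc (elements p)) (length-elements p)

elements-↗ : ∀ (p : Subset m) → AllPairs Fin._<_ (elements p)
elements-↗ [] = []
elements-↗ (inside ∷ p) =
  Allₚ.map⁺ (All.universal (λ _ → z<s) (elements p)) ∷ map⁺ (AllPairs.map s<s (elements-↗ p))
elements-↗ (outside ∷ p) = map⁺ (AllPairs.map s<s (elements-↗ p))

∈-elements⁺ : ∀ {p : Subset m} {x} → x ∈ p → x ∈ₗ elements p
∈-elements⁺ {p = inside ∷ p} here = here refl
∈-elements⁺ {p = inside ∷ p} (there x∈p) = there (∈-map⁺ suc (∈-elements⁺ x∈p))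
∈-elements⁺ {p = outside ∷ p} (there x∈p) = ∈-map⁺ suc (∈-elements⁺ x∈p)

∈-elements⁻ : ∀ {p : Subset m} {x} → x ∈ₗ elements p → x ∈ p
∈-elements⁻ {p = inside ∷ p} (here refl) = here
∈-elements⁻ {p = inside ∷ p} (there x∈) = ∈-suc-elements⁻ x∈
  where
  ∈-suc-elements⁻ : ∀ {x} → x ∈ₗ map suc (elements p) → x ∈ inside ∷ p
  ∈-suc-elements⁻ x∈ with _ , y∈ , refl ← ∈-map⁻ suc x∈ = there (∈-elements⁻ y∈)
∈-elements⁻ {p = outside ∷ p} x∈ with _ , y∈ , refl ← ∈-map⁻ suc x∈ = there (∈-elements⁻ y∈)

fromList : List (Fin m) → Subset m
fromList = foldr (λ x p → ⁅ x ⁆ ∪ p) ⊥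

∈-fromList⁺ : ∀ {xs : List (Fin m)} {x} → x ∈ₗ xs → x ∈ fromList xs
∈-fromList⁺ (here refl) = x∈p∪q⁺ (inj₁ (x∈⁅x⁆ _))
∈-fromList⁺ (there x∈xs) = x∈p∪q⁺ (inj₂ (∈-fromList⁺ x∈xs))

∈-fromList⁻ : ∀ {xs : List (Fin m)} {x} → x ∈ fromList xs → x ∈ₗ xs
∈-fromList⁻ {xs = []} x∈ = ⊥-elim (∉⊥ x∈)
∈-fromList⁻ {xs = y ∷ ys} x∈ with x∈p∪q⁻ ⁅ y ⁆ (fromList ys) x∈
... | inj₁ x∈⁅y⁆ = here (x∈⁅y⁆⇒x≡y y x∈⁅y⁆)
... | inj₂ x∈ys = there (∈-fromList⁻ x∈ys)

fromList-elements : ∀ (p : Subset m) → fromList (elements p) ≡ p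
fromList-elements p = ⊆-antisym (∈-elements⁻ ∘ ∈-fromList⁻) (∈-fromList⁺ ∘ ∈-elements⁺)

elements-fromList : ∀ {xs : List (Fin m)} → AllPairs Fin._<_ xs → elements (fromList xs) ≡ xs
elements-fromList {xs = xs} xs↗ =
  strictlySorted-unique Finₚ.<-asym (elements-↗ (fromList xs)) xs↗ (∈-fromList⁻ ∘ ∈-elements⁻) (∈-elements⁺ ∘ ∈-fromList⁺)

∣fromList∣ : ∀ {xs : List (Fin m)} → AllPairs Fin._<_ xs → ∣ fromList xs ∣ ≡ length xs
∣fromList∣ {xs = xs} xs↗ = trans (sym (length-elements (fromList xs))) (cong length (elements-fromList xs↗))

pair : Fin m → Fin m → Subset m
pair u v = fromList (u ∷ v ∷ [])

triple : Fin m → Fin m → Fin m → Subset m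
triple x y z = fromList (x ∷ y ∷ z ∷ [])

∣p∣≡2⇒pair : ∀ {p : Subset m} → ∣ p ∣ ≡ 2 → ∃₂ λ u v → u Fin.< v × p ≡ pair u v
∣p∣≡2⇒pair {p = p} ∣p∣≡2
  with elements p | elements-↗ p | fromList-elements p | trans (length-elements p) ∣p∣≡2
... | u ∷ v ∷ [] | (u<v ∷ []) ∷ _ | p≡ | _ = u , v , u<v , sym p≡

∣p∣≡3⇒triple : ∀ {p : Subset m} → ∣ p ∣ ≡ 3 →
  ∃₂ λ x y → ∃ λ z → x Fin.< y × y Fin.< z × elements p ≡ x ∷ y ∷ z ∷ []
∣p∣≡3⇒triple {p = p} ∣p∣≡3 with elements p | elements-↗ p | trans (length-elements p) ∣p∣≡3
... | x ∷ y ∷ z ∷ [] | (x<y ∷ _) ∷ (y<z ∷ []) ∷ _ | _ = x , y , z , x<y , y<z , refl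

enumerate : ∀ (p : Subset m) → ∣ p ∣ ≡ suc n →
  Σ (ℕ → Fin m) λ a → (∀ {i j} → i < j → j ≤ n → a i Fin.< a j) × (∀ {i} → i ≤ n → a i ∈ p)
enumerate {zero} [] ()
enumerate {suc m} {n} p ∣p∣≡1+n = nth zero (elements p) , increasing , member
  where
  bound : ∀ {i} → i ≤ n → i < length (elements p)
  bound i≤n = subst (_ <_) (sym (trans (length-elements p) ∣p∣≡1+n)) (s<s i≤n)
  increasing : ∀ {i j} → i < j → j ≤ n → nth zero (elements p) i Fin.< nth zero (elements p) j
  increasing i<j j≤n = nth-AllPairs zero (elements-↗ p) i<j (bound j≤n)
  member : ∀ {i} → i ≤ n → nth zero (elements p) i ∈ p
  member i≤n = ∈-elements⁻ (nth-∈ zero (elements p) (bound i≤n))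

∣p++q∣ : ∀ (p : Subset m) (q : Subset n) → ∣ p ++ q ∣ ≡ ∣ p ∣ + ∣ q ∣
∣p++q∣ [] q = refl
∣p++q∣ (inside ∷ p) q = cong suc (∣p++q∣ p q)
∣p++q∣ (outside ∷ p) q = ∣p++q∣ p q

∈-++⁻ˡ : ∀ (p : Subset m) (q : Subset n) {c i} → splitAt m c ≡ inj₁ i → c ∈ p ++ q → i ∈ p
∈-++⁻ˡ {n = n} p q {c} {i} split c∈ = lookup⇒[]= i p (begin
  lookup p i              ≡⟨ lookup-++ˡ p q i ⟨
  lookup (p ++ q) (i ↑ˡ n) ≡⟨ cong (lookup (p ++ q)) (Finₚ.splitAt⁻¹-↑ˡ split) ⟩
  lookup (p ++ q) c        ≡⟨ []=⇒lookup c∈ ⟩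
  true                     ∎)
  where open ≡-Reasoning

∈-++⁻ʳ : ∀ (p : Subset m) (q : Subset n) {c j} → splitAt m c ≡ inj₂ j → c ∈ p ++ q → j ∈ q
∈-++⁻ʳ {m = m} p q {c} {j} split c∈ = lookup⇒[]= j q (begin
  lookup q j               ≡⟨ lookup-++ʳ p q j ⟨
  lookup (p ++ q) (m Fin.↑ʳ j) ≡⟨ cong (lookup (p ++ q)) (Finₚ.splitAt⁻¹-↑ʳ split) ⟩
  lookup (p ++ q) c        ≡⟨ []=⇒lookup c∈ ⟩
  true                     ∎)
  where open ≡-Reasoning

-- First differences of bit strings

_<ₗₑₓ_ : Vec Bool n → Vec Bool n → Set
_<ₗₑₓ_ = Lex-< _≡_ Bool._<_

firstDifference : ∀ {u v : Vec Bool n} → u <ₗₑₓ v → Fin n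
firstDifference (base ())
firstDifference (this Bool.f<t _) = zero
firstDifference (next refl u<v) = suc (firstDifference u<v)

firstDifference-ultrametric : ∀ {u v w : Vec Bool n}
  (u<v : u <ₗₑₓ v) (v<w : v <ₗₑₓ w) (u<w : u <ₗₑₓ w) →
  let i = firstDifference u<v; j = firstDifference v<w; k = firstDifference u<w in
  (i Fin.< j × k ≡ i) ⊎ (j Fin.< i × k ≡ j)
firstDifference-ultrametric (base ()) _ _
firstDifference-ultrametric (this Bool.f<t _) (next refl _) (this Bool.f<t _) = inj₁ (z<s , refl)
firstDifference-ultrametric (next refl _) (this Bool.f<t _) (this Bool.f<t _) = inj₂ (z<s , refl)
firstDifference-ultrametric (next refl u<v) (next refl v<w) (next refl u<w)
  with firstDifference-ultrametric u<v v<w u<w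
... | inj₁ (i<j , k≡i) = inj₁ (s<s i<j , cong suc k≡i)
... | inj₂ (j<i , k≡j) = inj₂ (s<s j<i , cong suc k≡j)

toBits : ∀ n → ℕ → Vec Bool n
toBits zero k = []
toBits (suc n) k with 2 ^ n ≤? k
... | yes _ = true ∷ toBits n (k ∸ 2 ^ n)
... | no _ = false ∷ toBits n k

toBits-mono : ∀ {j k} → j < k → k < 2 ^ n → toBits n j <ₗₑₓ toBits n k
toBits-mono {zero} {k = zero} () _
toBits-mono {zero} {k = suc k} _ (s<s ())
toBits-mono {suc n} {j} {k} j<k k<2^n with 2 ^ n ≤? j | 2 ^ n ≤? k
... | yes 2^n≤j | yes 2^n≤k = next refl (toBits-mono (∸-monoˡ-< j<k 2^n≤j) k∸2^n<2^n)
  where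
  k∸2^n<2^n : k ∸ 2 ^ n < 2 ^ n
  k∸2^n<2^n = subst (k ∸ 2 ^ n <_)
    (trans (cong (_∸ 2 ^ n) (cong (2 ^ n +_) (+-identityʳ (2 ^ n)))) (m+n∸m≡n (2 ^ n) (2 ^ n)))
    (∸-monoˡ-< k<2^n 2^n≤k)
... | yes 2^n≤j | no 2^n≰k = ⊥-elim (2^n≰k (<⇒≤ (≤-<-trans 2^n≤j j<k)))
... | no _ | yes _ = this Bool.f<t refl
... | no _ | no 2^n≰k = next refl (toBits-mono j<k (≰⇒> 2^n≰k))

-- Chains with ultrametric branching levels

module Gaps {N n : ℕ} (d : ℕ → ℕ → Fin N)
  (ultrametric : ∀ {i j k} → i < j → j < k → k ≤ n →
    (d i j Fin.< d j k × d i k ≡ d i j) ⊎ (d j k Fin.< d i j × d i k ≡ d j k))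
  (P : Fin N → Fin N → Set) where

  gap : ℕ → Fin N
  gap i = d i (suc i)

  ascending-gaps : (∀ {i j k} → i < j → j < k → k ≤ n → d i j Fin.< d j k × P (d i j) (d j k)) →
    AllPairs (λ u v → u Fin.< v × P u v) (applyUpTo gap n)
  ascending-gaps ascending = applyUpTo⁺₁ gap n λ {i} {j} i<j j<n →
    subst (λ x → x Fin.< gap j × P x (gap j)) (d≡gap i<j (<⇒≤ j<n)) (ascending i<j (n<1+n j) j<n)
    where
    d≡gap : ∀ {i j} → i < j → j ≤ n → d i j ≡ gap i
    d≡gap {i} i<j j≤n with m≤n⇒m<n∨m≡n i<j
    ... | inj₂ refl = refl
    ... | inj₁ 1+i<j with ultrametric (n<1+n i) 1+i<j j≤n
    ...   | inj₁ (_ , dij≡gap) = dij≡gap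
    ...   | inj₂ (lt , _) = ⊥-elim (Finₚ.<-asym lt (proj₁ (ascending (n<1+n i) 1+i<j j≤n)))

  descending-gaps : (∀ {i j k} → i < j → j < k → k ≤ n → d j k Fin.< d i j × P (d j k) (d i j)) →
    AllPairs (λ u v → u Fin.< v × P u v) (applyDownFrom gap n)
  descending-gaps descending = applyDownFrom⁺₁ gap n λ {i} {j} j<i i<n →
    subst (λ x → x Fin.< gap j × P x (gap j)) (d≡gap j<i i<n) (descending (n<1+n j) (s<s j<i) i<n)
    where
    d≡gap : ∀ {i j} → i ≤ j → suc j ≤ n → d i (suc j) ≡ gap j
    d≡gap {j = j} i≤j j<n with m≤n⇒m<n∨m≡n i≤j
    ... | inj₂ refl = refl
    ... | inj₁ i<j with ultrametric i<j (n<1+n j) j<n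
    ...   | inj₂ (_ , d≡gap) = d≡gap
    ...   | inj₁ (lt , _) = ⊥-elim (Finₚ.<-asym lt (proj₁ (descending i<j (n<1+n j) j<n)))

monoClique-fromList : ∀ {N r} (φ : Subset N → Subset r) (c : Fin r) (ys : List (Fin N)) →
  length ys ≡ n → AllPairs (λ u v → u Fin.< v × c ∈ φ (pair u v)) ys → MonoClique 2 n N r φ
monoClique-fromList φ c ys ∣ys∣ ys↗ =
  fromList ys , trans (∣fromList∣ (AllPairs.map proj₁ ys↗)) ∣ys∣ , c , coloured
  where
  coloured : ∀ e → e ⊆ fromList ys → ∣ e ∣ ≡ 2 → c ∈ φ e
  coloured e e⊆ys ∣e∣≡2 with u , v , u<v , refl ← ∣p∣≡2⇒pair {p = e} ∣e∣≡2 =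
    oriented (AllPairs-∈ ys↗ (member (here refl)) (member (there (here refl))) (Finₚ.<⇒≢ u<v))
    where
    member : ∀ {x} → x ∈ₗ u ∷ v ∷ [] → x ∈ₗ ys
    member = ∈-fromList⁻ ∘ e⊆ys ∘ ∈-fromList⁺
    oriented : (u Fin.< v × c ∈ φ (pair u v)) ⊎ (v Fin.< u × c ∈ φ (pair v u)) → c ∈ φ (pair u v)
    oriented (inj₁ (_ , c∈)) = c∈
    oriented (inj₂ (v<u , _)) = ⊥-elim (Finₚ.<-asym u<v v<u)

-- The stepping-up colouring

module SteppingUp {N M r : ℕ} (1≤N : 1 ≤ N) (M≤2^N : M ≤ 2 ^ N) (φ : Subset N → Subset r) where

  encode : Fin M → Vec Bool N
  encode x = toBits N (toℕ x)

  encode-mono : ∀ {x y} → x Fin.< y → encode x <ₗₑₓ encode y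
  encode-mono {y = y} x<y = toBits-mono x<y (<-≤-trans (Finₚ.toℕ<n y) M≤2^N)

  -- The value for x ≮ y is junk and never used.
  δ : Fin M → Fin M → Fin N
  δ x y with x Fin.<? y
  ... | yes x<y = firstDifference (encode-mono x<y)
  ... | no _ = fromℕ< 1≤N

  δ-firstDifference : ∀ {x y} (x<y : x Fin.< y) → δ x y ≡ firstDifference (encode-mono x<y)
  δ-firstDifference {x} {y} x<y with x Fin.<? y
  ... | yes x<y′ = cong (firstDifference ∘ encode-mono) (Finₚ.<-irrelevant x<y′ x<y)
  ... | no x≮y = ⊥-elim (x≮y x<y)

  δ-ultrametric : ∀ {x y z} → x Fin.< y → y Fin.< z →
    (δ x y Fin.< δ y z × δ x z ≡ δ x y) ⊎ (δ y z Fin.< δ x y × δ x z ≡ δ y z)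
  δ-ultrametric x<y y<z
    rewrite δ-firstDifference x<y | δ-firstDifference y<z | δ-firstDifference (Finₚ.<-trans x<y y<z)
    = firstDifference-ultrametric (encode-mono x<y) (encode-mono y<z) (encode-mono (Finₚ.<-trans x<y y<z))

  δ-≮⇒> : ∀ {x y z} → x Fin.< y → y Fin.< z → ¬ δ x y Fin.< δ y z → δ y z Fin.< δ x y
  δ-≮⇒> x<y y<z ≮ with δ-ultrametric x<y y<z
  ... | inj₁ (lt , _) = ⊥-elim (≮ lt)
  ... | inj₂ (gt , _) = gt

  -- 2 * r is r + (r + 0): ascending triples use the first copy of the r
  -- colours, descending ones the second.
  left right : Subset r → Subset (2 * r)
  left X = X ++ ⊥
  right X = ⊥ {r} ++ X ++ []

  ∣left∣ : ∀ X → ∣ left X ∣ ≡ ∣ X ∣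
  ∣left∣ X = trans (∣p++q∣ X ⊥) (trans (cong (∣ X ∣ +_) (∣⊥∣≡0 (r + 0))) (+-identityʳ ∣ X ∣))

  ∣right∣ : ∀ X → ∣ right X ∣ ≡ ∣ X ∣
  ∣right∣ X = trans (∣p++q∣ (⊥ {r}) (X ++ []))
    (cong₂ _+_ (∣⊥∣≡0 r) (trans (∣p++q∣ X []) (+-identityʳ ∣ X ∣)))

  chainColour : Fin M → Fin M → Fin M → Subset (2 * r)
  chainColour x y z with δ x y Fin.<? δ y z
  ... | yes _ = left (φ (pair (δ x y) (δ y z)))
  ... | no _ = right (φ (pair (δ y z) (δ x y)))

  colourOfList : List (Fin M) → Subset (2 * r)
  colourOfList (x ∷ y ∷ z ∷ []) = chainColour x y z
  colourOfList _ = ⊥   -- not an edge of the 3-uniform hypergraph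

  χ : Subset M → Subset (2 * r)
  χ e = colourOfList (elements e)

  χ-isColoring : ∀ {s} → IsRSColoring 2 N r s φ → IsRSColoring 3 M (2 * r) s χ
  χ-isColoring {s} φ-col e ∣e∣≡3 with x , y , z , x<y , y<z , e≡xyz ← ∣p∣≡3⇒triple {p = e} ∣e∣≡3 =
    trans (cong (∣_∣ ∘ colourOfList) e≡xyz) ∣chainColour∣
    where
    ∣φpair∣ : ∀ {u v} → u Fin.< v → ∣ φ (pair u v) ∣ ≡ s
    ∣φpair∣ u<v = φ-col _ (∣fromList∣ ((u<v ∷ []) ∷ [] ∷ []))
    ∣chainColour∣ : ∣ chainColour x y z ∣ ≡ s
    ∣chainColour∣ with δ x y Fin.<? δ y z
    ... | yes lt = trans (∣left∣ (φ (pair (δ x y) (δ y z)))) (∣φpair∣ lt)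
    ... | no ≮ = trans (∣right∣ (φ (pair (δ y z) (δ x y)))) (∣φpair∣ (δ-≮⇒> x<y y<z ≮))

  ∈-chainColour-left : ∀ {κ c x y z} → splitAt r κ ≡ inj₁ c → κ ∈ chainColour x y z →
    δ x y Fin.< δ y z × c ∈ φ (pair (δ x y) (δ y z))
  ∈-chainColour-left {x = x} {y} {z} split κ∈ with δ x y Fin.<? δ y z
  ... | yes lt = lt , ∈-++⁻ˡ (φ (pair (δ x y) (δ y z))) ⊥ split κ∈
  ... | no _ = ⊥-elim (∉⊥ (∈-++⁻ˡ (⊥ {r}) (φ (pair (δ y z) (δ x y)) ++ []) split κ∈))

  ∈-chainColour-right : ∀ {κ j c x y z} → x Fin.< y → y Fin.< z →
    splitAt r κ ≡ inj₂ j → splitAt r j ≡ inj₁ c → κ ∈ chainColour x y z →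
    δ y z Fin.< δ x y × c ∈ φ (pair (δ y z) (δ x y))
  ∈-chainColour-right {x = x} {y} {z} x<y y<z split split′ κ∈ with δ x y Fin.<? δ y z
  ... | yes _ = ⊥-elim (∉⊥ (∈-++⁻ʳ (φ (pair (δ x y) (δ y z))) ⊥ split κ∈))
  ... | no ≮ = δ-≮⇒> x<y y<z ≮ , ∈-++⁻ˡ X [] split′ (∈-++⁻ʳ (⊥ {r}) (X ++ []) split κ∈)
    where X = φ (pair (δ y z) (δ x y))

  module Clique {n} {S : Subset M} (κ : Fin (2 * r)) (κ∈χ : ∀ e → e ⊆ S → ∣ e ∣ ≡ 3 → κ ∈ χ e)
    (a : ℕ → Fin M) (a-mono : ∀ {i j} → i < j → j ≤ n → a i Fin.< a j) (a∈S : ∀ {i} → i ≤ n → a i ∈ S) where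

    d : ℕ → ℕ → Fin N
    d i j = δ (a i) (a j)

    ordered : ∀ {i j k} → i < j → j < k → k ≤ n → a i Fin.< a j × a j Fin.< a k
    ordered i<j j<k k≤n = a-mono i<j (<⇒≤ (<-≤-trans j<k k≤n)) , a-mono j<k k≤n

    ultrametric : ∀ {i j k} → i < j → j < k → k ≤ n →
      (d i j Fin.< d j k × d i k ≡ d i j) ⊎ (d j k Fin.< d i j × d i k ≡ d j k)
    ultrametric i<j j<k k≤n = let ai<aj , aj<ak = ordered i<j j<k k≤n in δ-ultrametric ai<aj aj<ak

    κ∈chainColour : ∀ {i j k} → i < j → j < k → k ≤ n → κ ∈ chainColour (a i) (a j) (a k)
    κ∈chainColour {i} {j} {k} i<j j<k k≤n =
      subst (κ ∈_) (cong colourOfList (elements-fromList aijk↗)) (κ∈χ (triple (a i) (a j) (a k)) aijk⊆S (∣fromList∣ aijk↗))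
      where
      ai<aj : a i Fin.< a j
      ai<aj = proj₁ (ordered i<j j<k k≤n)
      aj<ak : a j Fin.< a k
      aj<ak = proj₂ (ordered i<j j<k k≤n)
      aijk↗ : AllPairs Fin._<_ (a i ∷ a j ∷ a k ∷ [])
      aijk↗ = (ai<aj ∷ Finₚ.<-trans ai<aj aj<ak ∷ []) ∷ (aj<ak ∷ []) ∷ [] ∷ []
      j≤n = <⇒≤ (<-≤-trans j<k k≤n)
      aijk⊆S : triple (a i) (a j) (a k) ⊆ S
      aijk⊆S x∈ with ∈-fromList⁻ {xs = a i ∷ a j ∷ a k ∷ []} x∈
      ... | here refl = a∈S (<⇒≤ (<-≤-trans i<j j≤n))
      ... | there (here refl) = a∈S j≤n
      ... | there (there (here refl)) = a∈S k≤n
      ... | there (there (there ()))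

    monoClique : MonoClique 2 n N r φ
    monoClique with splitAt r κ in split
    ... | inj₁ c = monoClique-fromList φ c (applyUpTo gap n) (length-applyUpTo gap n)
          (ascending-gaps λ {i} {j} {k} i<j j<k k≤n →
            ∈-chainColour-left {x = a i} {y = a j} {z = a k} split (κ∈chainColour i<j j<k k≤n))
      where open Gaps d ultrametric (λ u v → c ∈ φ (pair u v))
    ... | inj₂ j with splitAt r j in split′
    ...   | inj₁ c = monoClique-fromList φ c (applyDownFrom gap n) (length-applyDownFrom gap n)
          (descending-gaps λ i<j j<k k≤n → let ai<aj , aj<ak = ordered i<j j<k k≤n in
            ∈-chainColour-right ai<aj aj<ak split split′ (κ∈chainColour i<j j<k k≤n))
      where open Gaps d ultrametric (λ u v → c ∈ φ (pair u v))

  monoClique-stepDown : ∀ {n} → MonoClique 3 (n + 1) M (2 * r) χ → MonoClique 2 n N r φ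
  monoClique-stepDown {n} (S , ∣S∣≡n+1 , κ , κ∈χ)
    with a , a-mono , a∈S ← enumerate S (trans ∣S∣≡n+1 (+-comm n 1)) = Clique.monoClique κ κ∈χ a a-mono a∈S

theorem5p2 : (N n r s : ℕ) → 1 ≤ N → 1 ≤ n → 1 ≤ r → 1 ≤ s →
    3 ≤ n → s < r → RamseyGt 2 n r s N →
    RamseyGt 3 (n + 1) (2 * r) s (2 ^ N)
theorem5p2 N n r s 1≤N _ _ _ _ _ R₂>N M M≤2^N M→triples = R₂>N N ≤-refl λ φ φ-col →
  let open SteppingUp 1≤N M≤2^N φ in monoClique-stepDown (M→triples χ (χ-isColoring φ-col))
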